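{- Let $r,n$ be integers with $r\geq 3$ and $n\geq 2$, and let $G$ be a finite simple $K_{1,r}$-free graph. If $\delta(G)\geq \left\lfloor\frac{r+n-2}{n}\right\rfloor$, then $G$ has an $\mathcal{S}_n$-factor.
   Context: All graphs are finite and simple. $\delta(G)$ is the minimum degree of $G$. $K_{1,r}$ denotes the star with one center vertex adjacent to $r$ leaves. A graph $G$ is $K_{1,r}$-free if it contains no induced subgraph isomorphic to $K_{1,r}$. For a family $\mathcal{F}$ of connected graphs, an $\mathcal{F}$-factor of $G$ is a spanning subgraph $H$ of $G$ each of whose connected components is isomorphic to some graph in $\mathcal{F}$. An $\mathcal{S}_n$-factor is an $\mathcal{F}$-factor with $\mathcal{F}=\{K_{1,1},K_{1,2},\dots,K_{1,n}\}$ (where $K_{1,1}=K_2$). -}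

module Defs where

open import Level using (0ℓ)
open import Data.Nat using (ℕ; _≤_; _/_; _+_; _∸_)
open import Data.Fin using (Fin; _≟_)
open import Relation.Nullary using (¬?)
open import Relation.Nullary.Decidable using (_×-dec_)
open import Data.Vec using (count; allFin)
open import Data.Product using (Σ; _×_)
open import Relation.Nullary using (¬_; Dec)
open import Relation.Binary.PropositionalEquality using (_≡_; _≢_)
open import Relation.Unary using (Pred)
open import Relation.Binary using (Rel; Decidable)
open import Function.Definitions using (Injective)

record Graph (v : ℕ) : Set₁ where
  field
    Adj      : Rel (Fin v) 0ℓ
    adj?     : Decidable Adj
    sym      : ∀ {x y} → Adj x y → Adj y x
    irrefl   : ∀ {x} → ¬ Adj x x

module _ {v : ℕ} (G : Graph v) where
  open Graph G

  degree : Fin v → ℕ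
  degree x = count (adj? x) (allFin v)

  MinDegreeAtLeast : ℕ → Set
  MinDegreeAtLeast k = ∀ x → k ≤ degree x

  -- induced K_{1,r}: a centre c and r distinct vertices (leaves), each
  -- adjacent to c, pairwise non-adjacent.
  -- (Leaves adjacent to c are automatically distinct from c.)
  InducedStar : ℕ → Set
  InducedStar r =
    Σ (Fin v) λ c → Σ (Fin r → Fin v) λ f →
      Injective _≡_ _≡_ f × (∀ i → Adj c (f i)) × (∀ i j → ¬ Adj (f i) (f j))

  K1r-free : ℕ → Set
  K1r-free r = ¬ InducedStar r

  -- An S_n-factor (spanning subgraph each of whose components is K_{1,k},
  -- 1 ≤ k ≤ n), encoded by assigning to every vertex the centre of the
  -- star containing it.  Centres are fixed points; every other vertex x is
  -- a leaf joined (in G) to its centre s x; the factor's edges are exactly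
  -- {x, s x} for leaves x.  Each centre has between 1 and n leaves.
  -- (For K_{1,1} = K_2 either endpoint may serve as the centre.)

  leafCount : (Fin v → Fin v) → Fin v → ℕ
  leafCount s c = count (λ x → s x ≟ c ×-dec ¬? (x ≟ c)) (allFin v)

  record SnFactor (n : ℕ) : Set where
    field
      s          : Fin v → Fin v
      centre-fix : ∀ x → s (s x) ≡ s x
      leaf-adj   : ∀ x → s x ≢ x → Adj (s x) x
      leaf-count : ∀ c → s c ≡ c → 1 ≤ leafCount s c × leafCount s c ≤ n

-- A spanning forest of stars is encoded by the map sending each vertex to the centre of its star.
-- Its potential sums, over the centres, 2 for an isolated vertex and the excess (leaves ∸ n) otherwise,
-- so it vanishes exactly on S_n-factors. Starting from the forest of isolated vertices, it suffices to
-- decrease a positive potential. An isolated vertex joins a neighbouring star, after detaching that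
-- neighbour from its own star if it is a leaf. From an overfull star we search for an augmenting path
-- that alternates between a leaf and an adjacent centre of a star with n leaves: shifting leaves along
-- it keeps the potential, and any other kind of neighbour of the current leaf gives a strict decrease.
-- If the search gets stuck, the set R of centres reached is closed: every neighbour of a leaf of an
-- R-star is in R. Those leaves are then independent, there are more than n|R| of them, and each has at
-- least k = ⌊(r+n−2)/n⌋ neighbours, all in R, so some centre in R is adjacent to more than kn ≥ r − 1
-- of them: an induced K_{1,r}.

{-# OPTIONS --safe #-}
module Submission where

open import Defs

open import Algebra.Properties.CommutativeSemigroup using (xy∙z≈xz∙y; xy∙z≈x∙zy; xy∙z≈zy∙x)
open import Data.Empty using (⊥; ⊥-elim)
open import Data.Fin using (Fin; zero; suc; _≟_; punchIn)
open import Data.Fin.Properties as Fin using (punchInᵢ≢i; any?)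
open import Data.Fin.Subset using (Subset; _∈_; _∉_; _⊆_; _⊂_; _⊃_; ⁅_⁆; _∪_)
open import Data.Fin.Subset.Induction using (⊃-wellFounded)
open import Data.Fin.Subset.Properties using (_∈?_; p⊆p∪q; x∈p∪q⁺; x∈p∪q⁻; x∈⁅x⁆; x∈⁅y⁆⇒x≡y)
open import Data.Nat using (ℕ; zero; suc; _+_; _*_; _∸_; _≤_; _<_; z≤n; s≤s; NonZero; _/_; _%_)
open import Data.Nat.DivMod using (m≡m%n+[m/n]*n; m%n<n; m≥n⇒m/n>0)
open import Data.Nat.Induction using (<-wellFounded)
open import Data.Nat.Properties hiding (_≟_)
open import Data.Nat.Tactic.RingSolver using (solve-∀)
open import Data.Product as Prod using (_×_; _,_; proj₁; proj₂; ∃-syntax; Σ-syntax)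
open import Data.Sum as Sum using (_⊎_; inj₁; inj₂)
open import Data.Vec using (count; tabulate)
open import Data.Vec.Functional using (updateAt)
open import Data.Vec.Functional.Properties using (updateAt-updates; updateAt-minimal)
open import Function using (_∘_; _on_; const; flip)
open import Function.Definitions using (Injective)
open import Induction.WellFounded using (Acc; acc)
open import Relation.Binary.Construct.On as On using ()
open import Relation.Binary.PropositionalEquality
open import Relation.Nullary using (¬_; Dec; yes; no; ¬?; contradiction)
open import Relation.Nullary.Decidable using (_×-dec_)
open import Relation.Unary using (Pred; Decidable)

open import Algebra.Properties.Semiring.Sum +-*-semiring
  using (sum; sum-syntax; sum-cong-≗; sum-remove; ∑-distrib-+; ∑-comm; *-distribˡ-sum; sum-replicate-zero)

𝟙 : ∀ {p} {P : Set p} → Dec P → ℕ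
𝟙 (yes _) = 1
𝟙 (no _)  = 0

𝟙-yes : ∀ {p} {P : Set p} (d : Dec P) → P → 𝟙 d ≡ 1
𝟙-yes (yes _) _  = refl
𝟙-yes (no ¬p) p = contradiction p ¬p

𝟙-no : ∀ {p} {P : Set p} (d : Dec P) → ¬ P → 𝟙 d ≡ 0
𝟙-no (yes p) ¬p = contradiction p ¬p
𝟙-no (no _)  _  = refl

𝟙-witness : ∀ {p} {P : Set p} (d : Dec P) → 0 < 𝟙 d → P
𝟙-witness (yes p) _ = p

𝟙-mono : ∀ {p q} {P : Set p} {Q : Set q} (d : Dec P) (e : Dec Q) → (P → Q) → 𝟙 d ≤ 𝟙 e
𝟙-mono (yes p) e f = ≤-reflexive (sym (𝟙-yes e (f p)))
𝟙-mono (no _)  e f = z≤n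

𝟙-cong : ∀ {p q} {P : Set p} {Q : Set q} (d : Dec P) (e : Dec Q) → (P → Q) → (Q → P) → 𝟙 d ≡ 𝟙 e
𝟙-cong d e f g = ≤-antisym (𝟙-mono d e f) (𝟙-mono e d g)

𝟙-× : ∀ {p q} {P : Set p} {Q : Set q} (d : Dec P) (e : Dec Q) → 𝟙 d * 𝟙 e ≡ 𝟙 (d ×-dec e)
𝟙-× (yes p) (yes q) = sym (𝟙-yes (yes p ×-dec yes q) (p , q))
𝟙-× (yes p) (no ¬q) = sym (𝟙-no (yes p ×-dec no ¬q) (¬q ∘ proj₂))
𝟙-× (no ¬p) e       = sym (𝟙-no (no ¬p ×-dec e) (¬p ∘ proj₁))

sum-mono-≤ : ∀ {m} {f g : Fin m → ℕ} → (∀ i → f i ≤ g i) → sum f ≤ sum g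
sum-mono-≤ {zero}  _   = z≤n
sum-mono-≤ {suc m} f≤g = +-mono-≤ (f≤g zero) (sum-mono-≤ (f≤g ∘ suc))

≤-sum : ∀ {m} (f : Fin m → ℕ) i → f i ≤ sum f
≤-sum f zero    = m≤m+n _ _
≤-sum f (suc i) = ≤-trans (≤-sum (f ∘ suc) i) (m≤n+m _ _)

sum-agree-off : ∀ {m} {f g : Fin m → ℕ} i → (∀ j → j ≢ i → f j ≡ g j) →
                sum f + g i ≡ sum g + f i
sum-agree-off {suc m} {f} {g} i f≐g = begin
  sum f + g i                             ≡⟨ cong (_+ g i) (sum-remove f) ⟩
  f i + sum (f ∘ punchIn i) + g i         ≡⟨ xy∙z≈zy∙x +-commutativeSemigroup (f i) _ (g i) ⟩
  g i + sum (f ∘ punchIn i) + f i         ≡⟨ cong (λ t → g i + t + f i) rest ⟩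
  g i + sum (g ∘ punchIn i) + f i         ≡⟨ cong (_+ f i) (sum-remove g) ⟨
  sum g + f i                             ∎
  where
  open ≡-Reasoning
  rest : sum (f ∘ punchIn i) ≡ sum (g ∘ punchIn i)
  rest = sum-cong-≗ (λ j → f≐g (punchIn i j) (punchInᵢ≢i i j))

sum-agree-off₂ : ∀ {m} {f g : Fin m → ℕ} a b → a ≢ b → (∀ j → j ≢ a → j ≢ b → f j ≡ g j) →
                 sum f + (g a + g b) ≡ sum g + (f a + f b)
sum-agree-off₂ {f = f} {g} a b a≢b f≐g = begin
  sum f + (g a + g b)     ≡⟨ +-assoc (sum f) (g a) (g b) ⟨
  sum f + g a + g b       ≡⟨ cong (λ t → sum f + t + g b) (updateAt-updates a f) ⟨
  sum f + h a + g b       ≡⟨ cong (_+ g b) (sum-agree-off a f≐h) ⟩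
  sum h + f a + g b       ≡⟨ xy∙z≈xz∙y +-commutativeSemigroup (sum h) (f a) (g b) ⟩
  sum h + g b + f a       ≡⟨ cong (_+ f a) (sum-agree-off b h≐g) ⟩
  sum g + h b + f a       ≡⟨ cong (λ t → sum g + t + f a) (updateAt-minimal b a f (a≢b ∘ sym)) ⟩
  sum g + f b + f a       ≡⟨ xy∙z≈x∙zy +-commutativeSemigroup (sum g) (f b) (f a) ⟩
  sum g + (f a + f b)     ∎
  where
  open ≡-Reasoning
  h : Fin _ → ℕ
  h = updateAt f a (const (g a))
  f≐h : ∀ j → j ≢ a → f j ≡ h j
  f≐h j j≢a = sym (updateAt-minimal j a f j≢a)
  h≐g : ∀ j → j ≢ b → h j ≡ g j
  h≐g j j≢b with j ≟ a
  ... | yes refl = updateAt-updates a f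
  ... | no  j≢a  = trans (updateAt-minimal j a f j≢a) (f≐g j j≢a j≢b)

sum-supported-at : ∀ {m} {f : Fin m → ℕ} i → (∀ j → j ≢ i → f j ≡ 0) → sum f ≡ f i
sum-supported-at {m} {f} i f≐0 = +-cancelʳ-≡ 0 (sum f) (f i) (begin
  sum f + 0               ≡⟨ sum-agree-off {g = const 0} i f≐0 ⟩
  sum {m} (const 0) + f i ≡⟨ cong (_+ f i) (sum-replicate-zero m) ⟩
  f i                     ≡⟨ +-identityʳ (f i) ⟨
  f i + 0                 ∎)
  where open ≡-Reasoning

pigeonhole : ∀ {m} (f g : Fin m → ℕ) → sum f < sum g → ∃[ i ] f i < g i
pigeonhole {suc m} f g ∑f<∑g with f zero <? g zero
... | yes f₀<g₀ = zero , f₀<g₀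
... | no  f₀≮g₀ = let i , fi<gi = pigeonhole (f ∘ suc) (g ∘ suc) tail< in suc i , fi<gi
  where
  tail< : sum (f ∘ suc) < sum (g ∘ suc)
  tail< = +-cancelˡ-< (g zero) _ _ (≤-<-trans (+-monoˡ-≤ _ (≮⇒≥ f₀≮g₀)) ∑f<∑g)

sum>0⇒∃ : ∀ {m} {f : Fin m → ℕ} → 0 < sum f → ∃[ i ] 0 < f i
sum>0⇒∃ {m} {f} ∑f>0 = pigeonhole (const 0) f (subst (_< sum f) (sym (sum-replicate-zero m)) ∑f>0)

count≡sum : ∀ {v a p} {A : Set a} {P : Pred A p} (P? : Decidable P) (f : Fin v → A) →
            count P? (tabulate f) ≡ ∑[ x < v ] 𝟙 (P? (f x))
count≡sum {zero}  P? f = refl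
count≡sum {suc v} P? f with P? (f zero)
... | yes _ = cong suc (count≡sum P? (f ∘ suc))
... | no  _ = count≡sum P? (f ∘ suc)

choose-distinct : ∀ {v p} {P : Pred (Fin v) p} (P? : Decidable P) r → r ≤ ∑[ x < v ] 𝟙 (P? x) →
                  Σ[ f ∈ (Fin r → Fin v) ] Injective _≡_ _≡_ f × (∀ i → P (f i))
choose-distinct         P? zero    _   = (λ ()) , (λ {i} → contradiction i Fin.¬Fin0) , (λ ())
choose-distinct {zero}  P? (suc r) ()
choose-distinct {suc v} P? (suc r) r<∑ with P? zero
... | no  _ = let f , f-inj , Pf = choose-distinct (P? ∘ suc) (suc r) r<∑
              in suc ∘ f , f-inj ∘ Fin.suc-injective , Pf
... | yes P₀ = let f , f-inj , Pf = choose-distinct (P? ∘ suc) r (≤-pred r<∑)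
               in zero ∷ᶠ f , ∷ᶠ-injective f-inj , λ { zero → P₀ ; (suc i) → Pf i }
  where
  _∷ᶠ_ : ∀ {r} → Fin (suc v) → (Fin r → Fin v) → Fin (suc r) → Fin (suc v)
  (a ∷ᶠ f) zero    = a
  (a ∷ᶠ f) (suc i) = suc (f i)
  ∷ᶠ-injective : ∀ {r} {f : Fin r → Fin v} → Injective _≡_ _≡_ f → Injective _≡_ _≡_ (zero ∷ᶠ f)
  ∷ᶠ-injective f-inj {zero}  {zero}  _  = refl
  ∷ᶠ-injective f-inj {suc i} {suc j} eq = cong suc (f-inj (Fin.suc-injective eq))

m+o≤n+p∧p<o⇒m<n : ∀ {m n o p} → m + o ≤ n + p → p < o → m < n
m+o≤n+p∧p<o⇒m<n {m} {n} {o} {p} m+o≤n+p p<o = +-cancelʳ-< o m n (≤-<-trans m+o≤n+p (+-monoʳ-< n p<o))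

m<[m/n]*n+n : ∀ m n .{{_ : NonZero n}} → m < m / n * n + n
m<[m/n]*n+n m n = begin-strict
  m                    ≡⟨ m≡m%n+[m/n]*n m n ⟩
  m % n + m / n * n    <⟨ +-monoˡ-< (m / n * n) (m%n<n m n) ⟩
  n + m / n * n        ≡⟨ +-comm n _ ⟩
  m / n * n + n        ∎
  where open ≤-Reasoning

module StarForests {v} (G : Graph v) where
  open Graph G renaming (sym to Adj-sym)

  record IsStarForest (w : Fin v → Fin v) : Set where
    field
      centre-fix : ∀ x → w (w x) ≡ w x
      leaf-adj   : ∀ x → w x ≢ x → Adj (w x) x
  open IsStarForest

  discrete-isStarForest : IsStarForest (λ x → x)
  discrete-isStarForest = record { centre-fix = λ _ → refl ; leaf-adj = λ x x≢x → contradiction refl x≢x }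

  leaf? : (w : Fin v → Fin v) (a z : Fin v) → Dec (w a ≡ z × a ≢ z)
  leaf? w a z = w a ≟ z ×-dec ¬? (a ≟ z)

  leaves : (Fin v → Fin v) → Fin v → ℕ
  leaves w z = ∑[ a < v ] 𝟙 (leaf? w a z)

  leafCount≡leaves : ∀ w z → leafCount G w z ≡ leaves w z
  leafCount≡leaves w z = count≡sum (λ a → leaf? w a z) (λ a → a)

  leaf⇒leaves>0 : ∀ {w a z} → w a ≡ z → a ≢ z → 0 < leaves w z
  leaf⇒leaves>0 {w} {a} {z} wa≡z a≢z =
    ≤-trans (≤-reflexive (sym (𝟙-yes (leaf? w a z) (wa≡z , a≢z)))) (≤-sum _ a)

  leaves≡0⇒no-leaf : ∀ {w x} → leaves w x ≡ 0 → ∀ a → w a ≡ x → a ≡ x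
  leaves≡0⇒no-leaf {w} {x} none a wa≡x with a ≟ x
  ... | yes a≡x = a≡x
  ... | no  a≢x = contradiction (subst (0 <_) none (leaf⇒leaves>0 wa≡x a≢x)) (<-irrefl refl)

  leaves-of-leaf : ∀ {w} → IsStarForest w → ∀ {z} → w z ≢ z → leaves w z ≡ 0
  leaves-of-leaf {w} F {z} wz≢z = trans (sum-cong-≗ no-leaf) (sum-replicate-zero v)
    where
    no-leaf : ∀ a → 𝟙 (leaf? w a z) ≡ 0
    no-leaf a = 𝟙-no (leaf? w a z) λ (wa≡z , _) →
      wz≢z (trans (cong w (sym wa≡z)) (trans (centre-fix F a) wa≡z))

  leaves>0⇒centre : ∀ {w} → IsStarForest w → ∀ {z} → 0 < leaves w z → w z ≡ z
  leaves>0⇒centre {w} F {z} leaves>0 with w z ≟ z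
  ... | yes wz≡z = wz≡z
  ... | no  wz≢z = contradiction (subst (0 <_) (leaves-of-leaf F wz≢z) leaves>0) (<-irrefl refl)

  leaf≢centre : ∀ (w : Fin v → Fin v) {y c} → w y ≢ y → w c ≡ c → y ≢ c
  leaf≢centre w wy≢y wc≡c y≡c = wy≢y (subst (λ t → w t ≡ t) (sym y≡c) wc≡c)

  _[_↦_] : (Fin v → Fin v) → Fin v → Fin v → Fin v → Fin v
  w [ x ↦ y ] = updateAt w x (const y)

  ↦-here : ∀ w x y → (w [ x ↦ y ]) x ≡ y
  ↦-here w x y = updateAt-updates x w

  ↦-elsewhere : ∀ w {x} y {z} → z ≢ x → (w [ x ↦ y ]) z ≡ w z
  ↦-elsewhere w {x} y {z} = updateAt-minimal z x w

  reattach-isStarForest : ∀ {w x y} → IsStarForest w → (∀ a → w a ≡ x → a ≡ x) →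
                          (y ≢ x → w y ≡ y × Adj x y) → IsStarForest (w [ x ↦ y ])
  reattach-isStarForest {w} {x} {y} F no-leaf target = record { centre-fix = fix ; leaf-adj = adj }
    where
    w′ = w [ x ↦ y ]
    fix : ∀ z → w′ (w′ z) ≡ w′ z
    fix z with z ≟ x | y ≟ x
    ... | yes refl | yes refl = cong w′ (↦-here w x x)
    ... | yes refl | no  y≢x  = begin
      w′ (w′ x) ≡⟨ cong w′ (↦-here w x y) ⟩
      w′ y      ≡⟨ ↦-elsewhere w y y≢x ⟩
      w y       ≡⟨ proj₁ (target y≢x) ⟩
      y         ≡⟨ ↦-here w x y ⟨
      w′ x      ∎
      where open ≡-Reasoning
    ... | no  z≢x  | _        = begin
      w′ (w′ z) ≡⟨ cong w′ (↦-elsewhere w y z≢x) ⟩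
      w′ (w z)  ≡⟨ ↦-elsewhere w y (z≢x ∘ no-leaf z) ⟩
      w (w z)   ≡⟨ centre-fix F z ⟩
      w z       ≡⟨ ↦-elsewhere w y z≢x ⟨
      w′ z      ∎
      where open ≡-Reasoning
    adj : ∀ z → w′ z ≢ z → Adj (w′ z) z
    adj z w′z≢z with z ≟ x
    ... | yes refl = subst (λ t → Adj t x) (sym (↦-here w x y))
                       (Adj-sym (proj₂ (target (w′z≢z ∘ trans (↦-here w x y)))))
    ... | no  z≢x  = subst (λ t → Adj t z) (sym (↦-elsewhere w y z≢x))
                       (leaf-adj F z (w′z≢z ∘ trans (↦-elsewhere w y z≢x)))

  leaves-↦ : ∀ w x y z {i j} → 𝟙 (leaf? w x z) ≡ i → 𝟙 (leaf? (w [ x ↦ y ]) x z) ≡ j →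
             leaves (w [ x ↦ y ]) z + i ≡ leaves w z + j
  leaves-↦ w x y z refl refl = sum-agree-off x λ a a≢x →
    𝟙-cong (leaf? (w [ x ↦ y ]) a z) (leaf? w a z)
      (λ (e , a≢z) → trans (sym (↦-elsewhere w y a≢x)) e , a≢z)
      (λ (e , a≢z) → trans (↦-elsewhere w y a≢x) e , a≢z)

  leaves-↦-target : ∀ w {x y} → y ≢ x → w x ≢ y → leaves (w [ x ↦ y ]) y ≡ suc (leaves w y)
  leaves-↦-target w {x} {y} y≢x wx≢y = begin
    leaves (w [ x ↦ y ]) y      ≡⟨ +-identityʳ _ ⟨
    leaves (w [ x ↦ y ]) y + 0  ≡⟨ leaves-↦ w x y y (𝟙-no (leaf? w x y) (wx≢y ∘ proj₁))
                                                  (𝟙-yes (leaf? (w [ x ↦ y ]) x y) (↦-here w x y , y≢x ∘ sym)) ⟩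
    leaves w y + 1              ≡⟨ +-comm _ 1 ⟩
    suc (leaves w y)            ∎
    where open ≡-Reasoning

  leaves-↦-source : ∀ w {x y} → w x ≢ x → w x ≢ y → suc (leaves (w [ x ↦ y ]) (w x)) ≡ leaves w (w x)
  leaves-↦-source w {x} {y} wx≢x wx≢y = begin
    suc (leaves (w [ x ↦ y ]) (w x))  ≡⟨ +-comm 1 _ ⟩
    leaves (w [ x ↦ y ]) (w x) + 1    ≡⟨ leaves-↦ w x y (w x) (𝟙-yes (leaf? w x (w x)) (refl , wx≢x ∘ sym))
                                                          (𝟙-no (leaf? (w [ x ↦ y ]) x (w x)) moved) ⟩
    leaves w (w x) + 0                ≡⟨ +-identityʳ _ ⟩
    leaves w (w x)                    ∎
    where
    open ≡-Reasoning
    moved : ¬ ((w [ x ↦ y ]) x ≡ w x × x ≢ w x)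
    moved (e , _) = wx≢y (trans (sym e) (↦-here w x y))

  leaves-↦-unchanged : ∀ w {x y z} → ¬ (w x ≡ z × x ≢ z) → ¬ (y ≡ z × x ≢ z) →
                       leaves (w [ x ↦ y ]) z ≡ leaves w z
  leaves-↦-unchanged w {x} {y} {z} not-before not-after = +-cancelʳ-≡ 0 _ _
    (leaves-↦ w x y z (𝟙-no (leaf? w x z) not-before) (𝟙-no (leaf? (w [ x ↦ y ]) x z) (not-after ∘ after)))
    where
    after : (w [ x ↦ y ]) x ≡ z × x ≢ z → y ≡ z × x ≢ z
    after (e , x≢z) = trans (sym (↦-here w x y)) e , x≢z

  leaves-↦-other : ∀ w {x y z} → z ≢ w x → z ≢ y → leaves (w [ x ↦ y ]) z ≡ leaves w z
  leaves-↦-other w z≢wx z≢y = leaves-↦-unchanged w (z≢wx ∘ sym ∘ proj₁) (z≢y ∘ sym ∘ proj₁)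

  leaves-↦-self : ∀ w {x y} → leaves (w [ x ↦ y ]) x ≡ leaves w x
  leaves-↦-self w = leaves-↦-unchanged w (λ (_ , x≢x) → x≢x refl) (λ (_ , x≢x) → x≢x refl)

  Adj⇒≢ : ∀ {x y} → Adj x y → y ≢ x
  Adj⇒≢ {x} adj y≡x = irrefl (subst (Adj x) y≡x adj)

  detach-isStarForest : ∀ {w y} → IsStarForest w → w y ≢ y → IsStarForest (w [ y ↦ y ])
  detach-isStarForest F wy≢y =
    reattach-isStarForest F (leaves≡0⇒no-leaf (leaves-of-leaf F wy≢y)) (λ y≢y → contradiction refl y≢y)

  join-isStarForest : ∀ {w x y} → IsStarForest w → leaves w x ≡ 0 → w y ≡ y → Adj x y →
                      IsStarForest (w [ x ↦ y ])
  join-isStarForest F none wy≡y adj = reattach-isStarForest F (leaves≡0⇒no-leaf none) (λ _ → wy≡y , adj)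

  degree≡sum : ∀ x → degree G x ≡ ∑[ y < v ] 𝟙 (adj? x y)
  degree≡sum x = count≡sum (adj? x) (λ y → y)

  module ClosedFamily {n : ℕ} (s : Fin v → Fin v) (R : Subset v)
                      (saturated : ∀ {c} → c ∈ R → s c ≡ c × n ≤ leaves s c)
                      (closed : ∀ ℓ y → s ℓ ∈ R → s ℓ ≢ ℓ → Adj ℓ y → y ∈ R) where

    R-leaf? : ∀ x → Dec (s x ∈ R × s x ≢ x)
    R-leaf? x = s x ∈? R ×-dec ¬? (s x ≟ x)

    R-leaf-neighbours : Fin v → ℕ
    R-leaf-neighbours y = ∑[ x < v ] 𝟙 (R-leaf? x ×-dec adj? x y)

    χR : Fin v → ℕ
    χR c = 𝟙 (c ∈? R)

    ∣R∣ ∣R-leaves∣ : ℕ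
    ∣R∣        = ∑[ c < v ] χR c
    ∣R-leaves∣ = ∑[ x < v ] 𝟙 (R-leaf? x)

    R-leaves-by-centre : ∑[ c < v ] (χR c * leaves s c) ≡ ∣R-leaves∣
    R-leaves-by-centre = begin
      ∑[ c < v ] (χR c * leaves s c)
        ≡⟨ sum-cong-≗ (λ c → *-distribˡ-sum (χR c) (λ x → 𝟙 (leaf? s x c))) ⟩
      ∑[ c < v ] ∑[ x < v ] (χR c * 𝟙 (leaf? s x c))
        ≡⟨ ∑-comm (λ c x → χR c * 𝟙 (leaf? s x c)) ⟩
      ∑[ x < v ] ∑[ c < v ] (χR c * 𝟙 (leaf? s x c))
        ≡⟨ sum-cong-≗ own-centre ⟩
      ∣R-leaves∣
        ∎
      where
      open ≡-Reasoning
      own-centre : ∀ x → ∑[ c < v ] (χR c * 𝟙 (leaf? s x c)) ≡ 𝟙 (R-leaf? x)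
      own-centre x = begin
        ∑[ c < v ] (χR c * 𝟙 (leaf? s x c))   ≡⟨ sum-supported-at (s x) elsewhere ⟩
        χR (s x) * 𝟙 (leaf? s x (s x))        ≡⟨ 𝟙-× (s x ∈? R) (leaf? s x (s x)) ⟩
        𝟙 (s x ∈? R ×-dec leaf? s x (s x))    ≡⟨ 𝟙-cong _ (R-leaf? x) (λ (c∈R , _ , x≢c) → c∈R , x≢c ∘ sym)
                                                                 (λ (c∈R , c≢x) → c∈R , refl , c≢x ∘ sym) ⟩
        𝟙 (R-leaf? x)                          ∎
        where
        elsewhere : ∀ c → c ≢ s x → χR c * 𝟙 (leaf? s x c) ≡ 0
        elsewhere c c≢sx = trans (cong (χR c *_) (𝟙-no (leaf? s x c) (c≢sx ∘ sym ∘ proj₁))) (*-zeroʳ (χR c))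

    many-R-leaves : ∀ {c₀} → c₀ ∈ R → n < leaves s c₀ → n * ∣R∣ + 1 ≤ ∣R-leaves∣
    many-R-leaves {c₀} c₀∈R c₀-over = begin
      n * ∣R∣ + 1                                        ≡⟨ cong₂ _+_ (*-distribˡ-sum n χR) (sym one) ⟩
      (∑[ c < v ] (n * χR c)) + (∑[ c < v ] 𝟙 (c ≟ c₀))  ≡⟨ ∑-distrib-+ (λ c → n * χR c) _ ⟨
      ∑[ c < v ] (n * χR c + 𝟙 (c ≟ c₀))                 ≤⟨ sum-mono-≤ bound ⟩
      ∑[ c < v ] (χR c * leaves s c)                     ≡⟨ R-leaves-by-centre ⟩
      ∣R-leaves∣                                         ∎
      where
      open ≤-Reasoning
      one : ∑[ c < v ] 𝟙 (c ≟ c₀) ≡ 1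
      one = trans (sum-supported-at c₀ (λ c → 𝟙-no (c ≟ c₀))) (𝟙-yes (c₀ ≟ c₀) refl)
      bound : ∀ c → n * χR c + 𝟙 (c ≟ c₀) ≤ χR c * leaves s c
      bound c with c ∈? R | c ≟ c₀
      ... | yes c∈R | yes refl = begin
        n * 1 + 1       ≡⟨ cong (_+ 1) (*-identityʳ n) ⟩
        n + 1           ≡⟨ +-comm n 1 ⟩
        suc n           ≤⟨ c₀-over ⟩
        leaves s c₀     ≡⟨ *-identityˡ _ ⟨
        1 * leaves s c₀ ∎
      ... | yes c∈R | no  _    = begin
        n * 1 + 0       ≡⟨ trans (+-identityʳ _) (*-identityʳ n) ⟩
        n               ≤⟨ proj₂ (saturated c∈R) ⟩
        leaves s c      ≡⟨ *-identityˡ _ ⟨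
        1 * leaves s c  ∎
      ... | no  c∉R | yes refl = contradiction c₀∈R c∉R
      ... | no  c∉R | no  _    = ≤-reflexive (trans (+-identityʳ _) (*-zeroʳ n))

    many-R-leaf-edges : ∀ {k} → MinDegreeAtLeast G k → k * ∣R-leaves∣ ≤ ∑[ y < v ] R-leaf-neighbours y
    many-R-leaf-edges {k} deg = begin
      k * ∣R-leaves∣                                      ≡⟨ *-distribˡ-sum k (λ x → 𝟙 (R-leaf? x)) ⟩
      ∑[ x < v ] (k * 𝟙 (R-leaf? x))                      ≤⟨ sum-mono-≤ bound ⟩
      ∑[ x < v ] ∑[ y < v ] 𝟙 (R-leaf? x ×-dec adj? x y)  ≡⟨ ∑-comm (λ x y → 𝟙 (R-leaf? x ×-dec adj? x y)) ⟩
      ∑[ y < v ] R-leaf-neighbours y                      ∎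
      where
      open ≤-Reasoning
      bound : ∀ x → k * 𝟙 (R-leaf? x) ≤ ∑[ y < v ] 𝟙 (R-leaf? x ×-dec adj? x y)
      bound x with R-leaf? x
      ... | no  _        = ≤-trans (≤-reflexive (*-zeroʳ k)) z≤n
      ... | yes x-R-leaf = begin
        k * 1                                       ≡⟨ *-identityʳ k ⟩
        k                                           ≤⟨ deg x ⟩
        degree G x                                  ≡⟨ degree≡sum x ⟩
        ∑[ y < v ] 𝟙 (adj? x y)                     ≡⟨ sum-cong-≗ (λ y → 𝟙-cong (adj? x y) (yes x-R-leaf ×-dec adj? x y)
                                                                                (x-R-leaf ,_) proj₂) ⟩
        ∑[ y < v ] 𝟙 (yes x-R-leaf ×-dec adj? x y)  ∎

    R-leaf-neighbours-outside : ∀ {y} → y ∉ R → R-leaf-neighbours y ≡ 0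
    R-leaf-neighbours-outside {y} y∉R = trans (sum-cong-≗ no-edge) (sum-replicate-zero v)
      where
      no-edge : ∀ x → 𝟙 (R-leaf? x ×-dec adj? x y) ≡ 0
      no-edge x = 𝟙-no (R-leaf? x ×-dec adj? x y) λ ((sx∈R , sx≢x) , adj) → y∉R (closed x y sx∈R sx≢x adj)

    crowded-vertex : ∀ {k c₀} → MinDegreeAtLeast G k → 1 ≤ k → c₀ ∈ R → n < leaves s c₀ →
                     ∃[ y ] k * n < R-leaf-neighbours y
    crowded-vertex {k} deg 1≤k c₀∈R c₀-over =
      let y , crowded = pigeonhole (λ y → k * n * χR y) R-leaf-neighbours total<
      in  y , inside y crowded
      where
      distrib : ∀ a b c → a * b * c + a ≡ a * (b * c + 1)
      distrib = solve-∀
      total< : ∑[ y < v ] (k * n * χR y) < ∑[ y < v ] R-leaf-neighbours y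
      total< = begin-strict
        ∑[ y < v ] (k * n * χR y)        ≡⟨ *-distribˡ-sum (k * n) χR ⟨
        k * n * ∣R∣                      <⟨ m<m+n _ 1≤k ⟩
        k * n * ∣R∣ + k                  ≡⟨ distrib k n ∣R∣ ⟩
        k * (n * ∣R∣ + 1)                ≤⟨ *-monoʳ-≤ k (many-R-leaves c₀∈R c₀-over) ⟩
        k * ∣R-leaves∣                   ≤⟨ many-R-leaf-edges deg ⟩
        ∑[ y < v ] R-leaf-neighbours y   ∎
        where open ≤-Reasoning
      inside : ∀ y → k * n * χR y < R-leaf-neighbours y → k * n < R-leaf-neighbours y
      inside y crowded with y ∈? R
      ... | yes _   = subst (_< R-leaf-neighbours y) (*-identityʳ (k * n)) crowded
      ... | no  y∉R = contradiction (subst (0 <_) (R-leaf-neighbours-outside y∉R) (≤-trans (s≤s z≤n) crowded)) λ ()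

    R-leaves-independent : ∀ {x x′} → s x ∈ R × s x ≢ x → s x′ ∈ R × s x′ ≢ x′ → ¬ Adj x x′
    R-leaves-independent {x} {x′} (sx∈R , sx≢x) (_ , sx′≢x′) adj =
      sx′≢x′ (proj₁ (saturated (closed x x′ sx∈R sx≢x adj)))

    induced-star : ∀ {r y} → r ≤ R-leaf-neighbours y → InducedStar G r
    induced-star {r} {y} r≤ =
      let f , f-inj , f-ok = choose-distinct (λ x → R-leaf? x ×-dec adj? x y) r r≤
      in  y , f , f-inj , (λ i → Adj-sym (proj₂ (f-ok i))) ,
          (λ i j → R-leaves-independent (proj₁ (f-ok i)) (proj₁ (f-ok j)))

  no-closed-saturated-family : ∀ {n r k} → K1r-free G r → MinDegreeAtLeast G k → 1 ≤ k → r ≤ k * n + 1 →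
    ∀ (s : Fin v → Fin v) (R : Subset v) {c₀} → c₀ ∈ R → n < leaves s c₀ →
    (∀ {c} → c ∈ R → s c ≡ c × n ≤ leaves s c) →
    (∀ ℓ y → s ℓ ∈ R → s ℓ ≢ ℓ → Adj ℓ y → y ∈ R) → ⊥
  no-closed-saturated-family {n} {r} {k} free deg 1≤k r≤kn+1 s R c₀∈R c₀-over saturated closed =
    let y , crowded = crowded-vertex deg 1≤k c₀∈R c₀-over
    in  free (induced-star (≤-trans r≤kn+1 (subst (_≤ R-leaf-neighbours y) (+-comm 1 (k * n)) crowded)))
    where open ClosedFamily s R saturated closed

  module Potential (n : ℕ) where

    -- An isolated vertex costs 2, so that it can join any neighbouring star, even one it makes overfull.
    cost : ℕ → ℕ
    cost zero    = 2
    cost (suc L) = suc L ∸ n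

    penalty : (Fin v → Fin v) → Fin v → ℕ
    penalty w z = 𝟙 (w z ≟ z) * cost (leaves w z)

    potential : (Fin v → Fin v) → ℕ
    potential w = ∑[ z < v ] penalty w z

    cost≡0⇒within : ∀ {L} → cost L ≡ 0 → 1 ≤ L × L ≤ n
    cost≡0⇒within {suc L} cost≡0 = s≤s z≤n , m∸n≡0⇒m≤n cost≡0

    cost>0⇒isolated⊎overfull : ∀ {L} → 0 < cost L → L ≡ 0 ⊎ n < L
    cost>0⇒isolated⊎overfull {zero}  _      = inj₁ refl
    cost>0⇒isolated⊎overfull {suc L} cost>0 = inj₂ (m∸n≢0⇒n<m (>⇒≢ cost>0))

    penalty-centre : ∀ w {z} → w z ≡ z → penalty w z ≡ cost (leaves w z)
    penalty-centre w {z} wz≡z = trans (cong (_* cost (leaves w z)) (𝟙-yes (w z ≟ z) wz≡z)) (*-identityˡ _)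

    penalty>0⇒centre : ∀ w {z} → 0 < penalty w z → w z ≡ z × 0 < cost (leaves w z)
    penalty>0⇒centre w {z} penalty>0 with w z ≟ z
    ... | yes wz≡z = wz≡z , subst (0 <_) (+-identityʳ _) penalty>0
    ... | no  _    = contradiction penalty>0 λ ()

    penalty-leaf : ∀ w {z} → w z ≢ z → penalty w z ≡ 0
    penalty-leaf w {z} wz≢z = cong (_* cost (leaves w z)) (𝟙-no (w z ≟ z) wz≢z)

    penalty-↦-other : ∀ w {x y z} → z ≢ x → z ≢ w x → z ≢ y → penalty (w [ x ↦ y ]) z ≡ penalty w z
    penalty-↦-other w {x} {y} {z} z≢x z≢wx z≢y = cong₂ _*_
      (𝟙-cong ((w [ x ↦ y ]) z ≟ z) (w z ≟ z) (trans (sym same)) (trans same))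
      (cong cost (leaves-↦-other w z≢wx z≢y))
      where
      same : (w [ x ↦ y ]) z ≡ w z
      same = ↦-elsewhere w y z≢x

    potential≡0⇒SnFactor : ∀ {w} → IsStarForest w → potential w ≡ 0 → SnFactor G n
    potential≡0⇒SnFactor {w} F P≡0 = record
      { s          = w
      ; centre-fix = centre-fix F
      ; leaf-adj   = leaf-adj F
      ; leaf-count = λ c wc≡c → subst (λ L → 1 ≤ L × L ≤ n) (sym (leafCount≡leaves w c))
                                   (cost≡0⇒within (trans (sym (penalty-centre w wc≡c)) (penalty≡0 c)))
      }
      where
      penalty≡0 : ∀ c → penalty w c ≡ 0
      penalty≡0 c = n≤0⇒n≡0 (subst (penalty w c ≤_) P≡0 (≤-sum (penalty w) c))

    potential-change : ∀ {w w′} a b → a ≢ b → (∀ j → j ≢ a → j ≢ b → penalty w′ j ≡ penalty w j) →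
                       ∀ {pa pb pa′ pb′} → penalty w a ≡ pa → penalty w b ≡ pb →
                       penalty w′ a ≡ pa′ → penalty w′ b ≡ pb′ →
                       potential w′ + (pa + pb) ≡ potential w + (pa′ + pb′)
    potential-change a b a≢b agree refl refl refl refl = sum-agree-off₂ a b a≢b agree

    detach-potential : ∀ {w y L} → IsStarForest w → w y ≢ y → leaves w (w y) ≡ suc L →
             potential (w [ y ↦ y ]) + cost (suc L) ≡ potential w + (2 + cost L)
    detach-potential {w} {y} {L} F wy≢y d-leaves = potential-change {w} {w [ y ↦ y ]} y d (wy≢y ∘ sym)
      (λ j j≢y j≢d → penalty-↦-other w j≢y j≢d j≢y)
      (penalty-leaf w wy≢y)
      (trans (penalty-centre w (centre-fix F y)) (cong cost d-leaves))
      (trans (penalty-centre (w [ y ↦ y ]) (↦-here w y y)) (cong cost (trans (leaves-↦-self w) (leaves-of-leaf F wy≢y))))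
      (trans (penalty-centre (w [ y ↦ y ]) (trans (↦-elsewhere w y wy≢y) (centre-fix F y)))
             (cong cost (suc-injective (trans (leaves-↦-source w wy≢y wy≢y) d-leaves))))
      where d = w y

    move-leaf-potential : ∀ {w x y L} → IsStarForest w → w x ≢ x → w y ≡ y → y ≢ x → y ≢ w x →
                leaves w (w x) ≡ suc L →
                potential (w [ x ↦ y ]) + (cost (suc L) + cost (leaves w y)) ≡
                potential w + (cost L + cost (suc (leaves w y)))
    move-leaf-potential {w} {x} {y} {L} F wx≢x wy≡y y≢x y≢o o-leaves =
      potential-change {w} {w [ x ↦ y ]} o y (y≢o ∘ sym) agree
      (trans (penalty-centre w (centre-fix F x)) (cong cost o-leaves))
      (penalty-centre w wy≡y)
      (trans (penalty-centre (w [ x ↦ y ]) (trans (↦-elsewhere w y wx≢x) (centre-fix F x)))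
             (cong cost (suc-injective (trans (leaves-↦-source w wx≢x (y≢o ∘ sym)) o-leaves))))
      (trans (penalty-centre (w [ x ↦ y ]) (trans (↦-elsewhere w y y≢x) wy≡y))
             (cong cost (leaves-↦-target w y≢x (y≢o ∘ sym))))
      where
      o = w x
      agree : ∀ j → j ≢ o → j ≢ y → penalty (w [ x ↦ y ]) j ≡ penalty w j
      agree j j≢o j≢y with j ≟ x
      ... | yes refl = trans (penalty-leaf (w [ x ↦ y ]) (y≢x ∘ trans (sym (↦-here w x y)))) (sym (penalty-leaf w wx≢x))
      ... | no  j≢x  = penalty-↦-other w j≢x j≢o j≢y

    move-isolated-potential : ∀ {w x y} → w x ≡ x → leaves w x ≡ 0 → w y ≡ y → y ≢ x →
                    potential (w [ x ↦ y ]) + (2 + cost (leaves w y)) ≡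
                    potential w + cost (suc (leaves w y))
    move-isolated-potential {w} {x} {y} wx≡x x-leaves wy≡y y≢x = potential-change {w} {w [ x ↦ y ]} x y (y≢x ∘ sym)
      (λ j j≢x j≢y → penalty-↦-other w j≢x (j≢x ∘ flip trans wx≡x) j≢y)
      (trans (penalty-centre w wx≡x) (cong cost x-leaves))
      (penalty-centre w wy≡y)
      (penalty-leaf (w [ x ↦ y ]) (y≢x ∘ trans (sym (↦-here w x y))))
      (trans (penalty-centre (w [ x ↦ y ]) (trans (↦-elsewhere w y y≢x) wy≡y))
             (cong cost (leaves-↦-target w y≢x (y≢x ∘ sym ∘ trans (sym wx≡x)))))

  module LocalMoves {n : ℕ} (2≤n : 2 ≤ n) where
    open Potential n public

    cost-within : ∀ {L} → L < n → cost (suc L) ≡ 0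
    cost-within = m≤n⇒m∸n≡0

    cost-beyond : ∀ {L} → n ≤ L → cost (suc L) ≡ suc (cost L)
    cost-beyond {zero}  n≤0 = contradiction (≤-trans 2≤n n≤0) λ ()
    cost-beyond {suc L} n≤L = +-∸-assoc 1 n≤L

    cost-suc-≤ : ∀ L → cost (suc L) ≤ suc (cost L)
    cost-suc-≤ L with n ≤? L
    ... | yes n≤L = ≤-reflexive (cost-beyond n≤L)
    ... | no  n≰L = ≤-trans (≤-reflexive (cost-within (≰⇒> n≰L))) z≤n

    cost-mono : ∀ L → cost (suc L) ≤ cost (suc (suc L))
    cost-mono L = ∸-monoˡ-≤ n (n≤1+n (suc L))

    cost-1 : cost 1 ≡ 0
    cost-1 = cost-within (≤-trans (s≤s z≤n) 2≤n)

    overfull⇒suc : ∀ {m} → n < m → ∃[ L ] m ≡ suc L × n ≤ L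
    overfull⇒suc {suc L} (s≤s n≤L) = L , refl , n≤L

    Improvable : (Fin v → Fin v) → Set
    Improvable w = ∃[ w′ ] IsStarForest w′ × potential w′ < potential w

    improvable-≤ : ∀ {w w′} → potential w′ ≤ potential w → Improvable w′ → Improvable w
    improvable-≤ P′≤P (w″ , F″ , P″<P′) = w″ , F″ , <-≤-trans P″<P′ P′≤P

    isolated-joins-centre : ∀ {w x y} → IsStarForest w → w x ≡ x → leaves w x ≡ 0 → w y ≡ y → Adj x y →
                            Improvable w
    isolated-joins-centre {w} {x} {y} F wx≡x none wy≡y adj =
      w [ x ↦ y ] , join-isStarForest F none wy≡y adj ,
      m+o≤n+p∧p<o⇒m<n (≤-reflexive (move-isolated-potential wx≡x none wy≡y (Adj⇒≢ adj)))
                      (s≤s (cost-suc-≤ (leaves w y)))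

    detach-cheap : ∀ {w y M} → IsStarForest w → w y ≢ y → leaves w (w y) ≡ suc (suc M) →
                   potential (w [ y ↦ y ]) ≤ potential w + 2
    detach-cheap {w} {y} {M} F wy≢y d-leaves = +-cancelʳ-≤ (cost (2 + M)) _ _ (begin
      potential (w [ y ↦ y ]) + cost (2 + M)   ≡⟨ detach-potential F wy≢y d-leaves ⟩
      potential w + (2 + cost (1 + M))         ≤⟨ +-monoʳ-≤ (potential w) (+-monoʳ-≤ 2 (cost-mono M)) ⟩
      potential w + (2 + cost (2 + M))         ≡⟨ +-assoc (potential w) 2 _ ⟨
      potential w + 2 + cost (2 + M)           ∎)
      where open ≤-Reasoning

    isolated-joins-isolated : ∀ {w x y} → w x ≡ x → leaves w x ≡ 0 → w y ≡ y → leaves w y ≡ 0 → y ≢ x →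
                              potential (w [ x ↦ y ]) + 4 ≡ potential w
    isolated-joins-isolated {w} {x} {y} wx≡x x-none wy≡y y-none y≢x = begin
      potential (w [ x ↦ y ]) + 4                        ≡⟨ cong (λ L → potential (w [ x ↦ y ]) + (2 + cost L)) y-none ⟨
      potential (w [ x ↦ y ]) + (2 + cost (leaves w y))  ≡⟨ move-isolated-potential wx≡x x-none wy≡y y≢x ⟩
      potential w + cost (suc (leaves w y))              ≡⟨ cong (λ L → potential w + cost (suc L)) y-none ⟩
      potential w + cost 1                               ≡⟨ cong (potential w +_) cost-1 ⟩
      potential w + 0                                    ≡⟨ +-identityʳ _ ⟩
      potential w                                        ∎
      where open ≡-Reasoning

    isolated-joins-star-leaf : ∀ {w x y M} → IsStarForest w → w x ≡ x → leaves w x ≡ 0 →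
                               w y ≢ y → leaves w (w y) ≡ suc (suc M) → Adj x y → Improvable w
    isolated-joins-star-leaf {w} {x} {y} {M} F wx≡x none wy≢y d-leaves adj =
      w₂ , join-isStarForest (detach-isStarForest F wy≢y) none₁ (↦-here w y y) adj ,
      m+o≤n+p∧p<o⇒m<n gain (s≤s (s≤s (s≤s z≤n)))
      where
      w₁ = w [ y ↦ y ]
      w₂ = w₁ [ x ↦ y ]
      x≢y : x ≢ y
      x≢y = Adj⇒≢ adj ∘ sym
      x≢d : x ≢ w y
      x≢d x≡d = 0≢1+n (trans (sym none) (trans (cong (leaves w) x≡d) d-leaves))
      none₁ : leaves w₁ x ≡ 0
      none₁ = trans (leaves-↦-other w x≢d x≢y) none
      gain : potential w₂ + 4 ≤ potential w + 2
      gain = begin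
        potential w₂ + 4  ≡⟨ isolated-joins-isolated {w₁} (trans (↦-elsewhere w y x≢y) wx≡x) none₁ (↦-here w y y)
                                                    (trans (leaves-↦-self w) (leaves-of-leaf F wy≢y)) (Adj⇒≢ adj) ⟩
        potential w₁      ≤⟨ detach-cheap F wy≢y d-leaves ⟩
        potential w + 2   ∎
        where open ≤-Reasoning

    record Recentring (w : Fin v → Fin v) (y : Fin v) : Set where
      field
        w′            : Fin v → Fin v
        isStarForest  : IsStarForest w′
        potential-≡   : potential w′ ≡ potential w
        centre        : w′ y ≡ y
        leaves-centre : leaves w′ y ≡ 1
        elsewhere     : ∀ {z} → z ≢ y → z ≢ w y → w′ z ≡ w z × leaves w′ z ≡ leaves w z

    recentre : ∀ {w y} → IsStarForest w → w y ≢ y → leaves w (w y) ≡ 1 → Recentring w y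
    recentre {w} {y} F wy≢y d-leaves = record
      { w′            = w₂
      ; isStarForest  = join-isStarForest F₁ d-leaves₁ (↦-here w y y) (leaf-adj F y wy≢y)
      ; potential-≡   = +-cancelʳ-≡ 4 _ _ balance
      ; centre        = trans (↦-elsewhere w₁ y y≢d) (↦-here w y y)
      ; leaves-centre = trans (leaves-↦-target w₁ y≢d (y≢d ∘ sym ∘ trans (sym w₁d≡d))) (cong suc y-leaves₁)
      ; elsewhere     = λ z≢y z≢d →
          trans (↦-elsewhere w₁ y z≢d) (↦-elsewhere w y z≢y) ,
          trans (leaves-↦-other w₁ (z≢d ∘ flip trans w₁d≡d) z≢y) (leaves-↦-other w z≢d z≢y)
      }
      where
      d  = w y
      w₁ = w [ y ↦ y ]
      w₂ = w₁ [ d ↦ y ]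
      F₁ = detach-isStarForest F wy≢y
      y≢d : y ≢ d
      y≢d = wy≢y ∘ sym
      w₁d≡d : w₁ d ≡ d
      w₁d≡d = trans (↦-elsewhere w y wy≢y) (centre-fix F y)
      d-leaves₁ : leaves w₁ d ≡ 0
      d-leaves₁ = suc-injective (trans (leaves-↦-source w wy≢y wy≢y) d-leaves)
      y-leaves₁ : leaves w₁ y ≡ 0
      y-leaves₁ = trans (leaves-↦-self w) (leaves-of-leaf F wy≢y)
      balance : potential w₂ + 4 ≡ potential w + 4
      balance = begin
        potential w₂ + 4       ≡⟨ isolated-joins-isolated {w₁} w₁d≡d d-leaves₁ (↦-here w y y) y-leaves₁ y≢d ⟩
        potential w₁           ≡⟨ +-identityʳ _ ⟨
        potential w₁ + 0       ≡⟨ cong (potential w₁ +_) cost-1 ⟨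
        potential w₁ + cost 1  ≡⟨ detach-potential F wy≢y d-leaves ⟩
        potential w + 4        ∎
        where open ≡-Reasoning

    isolated-joins-K₂-leaf : ∀ {w x y} → IsStarForest w → w x ≡ x → leaves w x ≡ 0 →
                             w y ≢ y → leaves w (w y) ≡ 1 → Adj x y → Improvable w
    isolated-joins-K₂-leaf {w} {x} {y} F wx≡x none wy≢y d-leaves adj =
      improvable-≤ {w} {w′} (≤-reflexive potential-≡)
        (isolated-joins-centre isStarForest (trans w′x≡wx wx≡x) (trans x-leaves′ none) centre adj)
      where
      open Recentring (recentre F wy≢y d-leaves)
      x≢y : x ≢ y
      x≢y = Adj⇒≢ adj ∘ sym
      x≢d : x ≢ w y
      x≢d x≡d = 0≢1+n (trans (sym none) (trans (cong (leaves w) x≡d) d-leaves))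
      w′x≡wx = proj₁ (elsewhere x≢y x≢d)
      x-leaves′ = proj₂ (elsewhere x≢y x≢d)

    overfull-leaf-joins-centre : ∀ {w x y} → IsStarForest w → w x ≢ x → n < leaves w (w x) →
                                 w y ≡ y → y ≢ w x → Adj x y →
                                 potential (w [ x ↦ y ]) + suc (cost (leaves w y)) ≡
                                 potential w + cost (suc (leaves w y))
    overfull-leaf-joins-centre {w} {x} {y} F wx≢x c-over wy≡y y≢c adj
      with L , c-leaves , n≤L ← overfull⇒suc c-over = +-cancelʳ-≡ (cost L) _ _ (begin
        P′ + suc cy + cost L                       ≡⟨ shuffle₁ P′ cy (cost L) ⟩
        P′ + (suc (cost L) + cy)                   ≡⟨ cong (λ t → P′ + (t + cy)) (cost-beyond n≤L) ⟨
        P′ + (cost (suc L) + cy)                   ≡⟨ move-leaf-potential F wx≢x wy≡y (Adj⇒≢ adj) y≢c c-leaves ⟩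
        P + (cost L + cost (suc (leaves w y)))     ≡⟨ shuffle₂ P (cost L) (cost (suc (leaves w y))) ⟩
        P + cost (suc (leaves w y)) + cost L       ∎)
      where
      open ≡-Reasoning
      P′ = potential (w [ x ↦ y ])
      P  = potential w
      cy = cost (leaves w y)
      shuffle₁ : ∀ a b c → a + suc b + c ≡ a + (suc c + b)
      shuffle₁ = solve-∀
      shuffle₂ : ∀ a b c → a + (b + c) ≡ a + c + b
      shuffle₂ = solve-∀

    overfull-leaf-joins-saturated-centre : ∀ {w x y} → IsStarForest w → w x ≢ x → n < leaves w (w x) →
                                           w y ≡ y → y ≢ w x → n ≤ leaves w y → Adj x y →
                                           potential (w [ x ↦ y ]) ≡ potential w
    overfull-leaf-joins-saturated-centre {w} {x} {y} F wx≢x c-over wy≡y y≢c saturated adj =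
      +-cancelʳ-≡ (suc (cost (leaves w y))) _ _
        (trans (overfull-leaf-joins-centre F wx≢x c-over wy≡y y≢c adj)
               (cong (potential w +_) (cost-beyond saturated)))

    overfull-leaf-joins-unsaturated-centre : ∀ {w x y} → IsStarForest w → w x ≢ x → n < leaves w (w x) →
                                             w y ≡ y → y ≢ w x → leaves w y < n → Adj x y → Improvable w
    overfull-leaf-joins-unsaturated-centre {w} {x} {y} F wx≢x c-over wy≡y y≢c unsaturated adj =
      w [ x ↦ y ] , join-isStarForest F (leaves-of-leaf F wx≢x) wy≡y adj ,
      m+o≤n+p∧p<o⇒m<n (≤-reflexive (trans (overfull-leaf-joins-centre F wx≢x c-over wy≡y y≢c adj)
                                    (cong (potential w +_) (cost-within unsaturated))))
                (s≤s z≤n)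

    detach-from-overfull : ∀ {w y} → IsStarForest w → w y ≢ y → n < leaves w (w y) →
                           potential (w [ y ↦ y ]) + 1 ≡ potential w + 2
    detach-from-overfull {w} {y} F wy≢y d-over with L , d-leaves , n≤L ← overfull⇒suc d-over =
      +-cancelʳ-≡ (cost L) _ _ (begin
        potential (w [ y ↦ y ]) + 1 + cost L   ≡⟨ +-assoc (potential (w [ y ↦ y ])) 1 (cost L) ⟩
        potential (w [ y ↦ y ]) + suc (cost L) ≡⟨ cong (potential (w [ y ↦ y ]) +_) (cost-beyond n≤L) ⟨
        potential (w [ y ↦ y ]) + cost (suc L) ≡⟨ detach-potential F wy≢y d-leaves ⟩
        potential w + (2 + cost L)             ≡⟨ +-assoc (potential w) 2 (cost L) ⟨
        potential w + 2 + cost L               ∎)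
      where open ≡-Reasoning

    leaf-joins-isolated : ∀ {w x y} → IsStarForest w → w x ≢ x → 1 < leaves w (w x) →
                          w y ≡ y → leaves w y ≡ 0 → y ≢ x → potential (w [ x ↦ y ]) + 2 ≤ potential w
    leaf-joins-isolated {w} {x} {y} F wx≢x o-leaves>1 wy≡y none y≢x with leaves w (w x) in o-leaves | o-leaves>1
    ... | suc zero    | s≤s ()
    ... | suc (suc M) | _ = +-cancelʳ-≤ (cost (2 + M)) _ _ (begin
      P′ + 2 + cost (2 + M)        ≡⟨ xy∙z≈x∙zy +-commutativeSemigroup P′ 2 _ ⟩
      P′ + (cost (2 + M) + 2)      ≡⟨ move ⟩
      P + (cost (1 + M) + cost 1)  ≡⟨ cong (λ t → P + (cost (1 + M) + t)) cost-1 ⟩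
      P + (cost (1 + M) + 0)       ≡⟨ cong (P +_) (+-identityʳ _) ⟩
      P + cost (1 + M)             ≤⟨ +-monoʳ-≤ P (cost-mono M) ⟩
      P + cost (2 + M)             ∎)
      where
      open ≤-Reasoning
      P′ = potential (w [ x ↦ y ])
      P  = potential w
      y≢o : y ≢ w x
      y≢o y≡o = 0≢1+n (trans (sym none) (trans (cong (leaves w) y≡o) o-leaves))
      move : P′ + (cost (2 + M) + 2) ≡ P + (cost (1 + M) + cost 1)
      move = subst (λ L → P′ + (cost (2 + M) + cost L) ≡ P + (cost (1 + M) + cost (suc L))) none
                   (move-leaf-potential F wx≢x wy≡y y≢x y≢o o-leaves)

    overfull-leaf-joins-sibling : ∀ {w x y} → IsStarForest w → w x ≢ x → n < leaves w (w x) →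
                                  w y ≢ y → w y ≡ w x → Adj x y → Improvable w
    overfull-leaf-joins-sibling {w} {x} {y} F wx≢x c-over wy≢y wy≡c adj =
      w₂ , join-isStarForest F₁ (leaves-of-leaf F₁ w₁x≢x) (↦-here w y y) adj ,
      m+o≤n+p∧p<o⇒m<n gain (s≤s (s≤s (s≤s z≤n)))
      where
      c  = w x
      w₁ = w [ y ↦ y ]
      w₂ = w₁ [ x ↦ y ]
      F₁ = detach-isStarForest F wy≢y
      x≢y : x ≢ y
      x≢y = Adj⇒≢ adj ∘ sym
      w₁x≡c : w₁ x ≡ c
      w₁x≡c = ↦-elsewhere w y x≢y
      w₁x≢x : w₁ x ≢ x
      w₁x≢x = wx≢x ∘ trans (sym w₁x≡c)
      d-over : n < leaves w (w y)
      d-over = subst (λ t → n < leaves w t) (sym wy≡c) c-over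
      c-leaves₁ : 1 < leaves w₁ (w₁ x)
      c-leaves₁ = subst (1 <_) (cong (leaves w₁) (trans wy≡c (sym w₁x≡c)))
                    (≤-trans 2≤n (≤-pred (subst (n <_) (sym (leaves-↦-source w wy≢y wy≢y)) d-over)))
      gain : potential w₂ + 3 ≤ potential w + 2
      gain = begin
        potential w₂ + 3           ≡⟨ +-assoc (potential w₂) 2 1 ⟨
        potential w₂ + 2 + 1       ≤⟨ +-monoˡ-≤ 1 (leaf-joins-isolated F₁ w₁x≢x c-leaves₁ (↦-here w y y)
                                        (trans (leaves-↦-self w) (leaves-of-leaf F wy≢y)) (x≢y ∘ sym)) ⟩
        potential w₁ + 1           ≡⟨ detach-from-overfull F wy≢y d-over ⟩
        potential w + 2            ∎
        where open ≤-Reasoning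

    overfull-leaf-joins-star-leaf : ∀ {w x y M} → IsStarForest w → w x ≢ x → n < leaves w (w x) →
                                    w y ≢ y → w y ≢ w x → leaves w (w y) ≡ suc (suc M) → Adj x y →
                                    Improvable w
    overfull-leaf-joins-star-leaf {w} {x} {y} F wx≢x c-over wy≢y wy≢c d-leaves adj =
      w₂ , join-isStarForest F₁ (leaves-of-leaf F₁ w₁x≢x) (↦-here w y y) adj ,
      m+o≤n+p∧p<o⇒m<n gain (s≤s (s≤s (s≤s z≤n)))
      where
      c  = w x
      w₁ = w [ y ↦ y ]
      w₂ = w₁ [ x ↦ y ]
      F₁ = detach-isStarForest F wy≢y
      x≢y : x ≢ y
      x≢y = Adj⇒≢ adj ∘ sym
      w₁x≡c : w₁ x ≡ c
      w₁x≡c = ↦-elsewhere w y x≢y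
      w₁x≢x : w₁ x ≢ x
      w₁x≢x = wx≢x ∘ trans (sym w₁x≡c)
      y≢c : y ≢ c
      y≢c = leaf≢centre w wy≢y (centre-fix F x)
      c-over₁ : n < leaves w₁ (w₁ x)
      c-over₁ = subst (n <_) (sym (trans (cong (leaves w₁) w₁x≡c) (leaves-↦-other w (wy≢c ∘ sym) (y≢c ∘ sym))))
                  c-over
      y-leaves₁ : leaves w₁ y ≡ 0
      y-leaves₁ = trans (leaves-↦-self w) (leaves-of-leaf F wy≢y)
      gain : potential w₂ + 3 ≤ potential w + 2
      gain = begin
        potential w₂ + 3                            ≡⟨ cong (λ L → potential w₂ + suc (cost L)) y-leaves₁ ⟨
        potential w₂ + suc (cost (leaves w₁ y))     ≡⟨ overfull-leaf-joins-centre F₁ w₁x≢x c-over₁ (↦-here w y y)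
                                                           (y≢c ∘ flip trans w₁x≡c) adj ⟩
        potential w₁ + cost (suc (leaves w₁ y))     ≡⟨ cong (λ L → potential w₁ + cost (suc L)) y-leaves₁ ⟩
        potential w₁ + cost 1                       ≡⟨ trans (cong (potential w₁ +_) cost-1) (+-identityʳ _) ⟩
        potential w₁                                ≤⟨ detach-cheap F wy≢y d-leaves ⟩
        potential w + 2                             ∎
        where open ≤-Reasoning

    overfull-leaf-joins-K₂-leaf : ∀ {w x y} → IsStarForest w → w x ≢ x → n < leaves w (w x) →
                                  w y ≢ y → w y ≢ w x → leaves w (w y) ≡ 1 → Adj x y → Improvable w
    overfull-leaf-joins-K₂-leaf {w} {x} {y} F wx≢x c-over wy≢y wy≢c d-leaves adj =
      improvable-≤ {w} {w′} (≤-reflexive potential-≡)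
        (overfull-leaf-joins-unsaturated-centre isStarForest w′x≢x c-over′ centre y≢w′x
          (subst (_< n) (sym leaves-centre) 2≤n) adj)
      where
      open Recentring (recentre F wy≢y d-leaves)
      c = w x
      x≢y : x ≢ y
      x≢y = Adj⇒≢ adj ∘ sym
      c≢y : c ≢ y
      c≢y = leaf≢centre w wy≢y (centre-fix F x) ∘ sym
      w′x≡c : w′ x ≡ c
      w′x≡c = proj₁ (elsewhere x≢y (leaf≢centre w wx≢x (centre-fix F y)))
      w′x≢x : w′ x ≢ x
      w′x≢x = wx≢x ∘ trans (sym w′x≡c)
      c-over′ : n < leaves w′ (w′ x)
      c-over′ = subst (n <_) (sym (trans (cong (leaves w′) w′x≡c) (proj₂ (elsewhere c≢y (wy≢c ∘ sym))))) c-over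
      y≢w′x : y ≢ w′ x
      y≢w′x y≡w′x = c≢y (sym (trans y≡w′x w′x≡c))

    isolated-joins-neighbour : ∀ {w x y} → IsStarForest w → w x ≡ x → leaves w x ≡ 0 → Adj x y →
                               Improvable w
    isolated-joins-neighbour {w} {x} {y} F wx≡x none adj with w y ≟ y
    ... | yes wy≡y = isolated-joins-centre F wx≡x none wy≡y adj
    ... | no  wy≢y with leaves w (w y) in d-leaves
    ...   | zero        = contradiction (subst (0 <_) d-leaves (leaf⇒leaves>0 {w} refl (wy≢y ∘ sym))) λ ()
    ...   | suc zero    = isolated-joins-K₂-leaf F wx≡x none wy≢y d-leaves adj
    ...   | suc (suc M) = isolated-joins-star-leaf F wx≡x none wy≢y d-leaves adj

    overfull-leaf-joins-leaf : ∀ {w x y} → IsStarForest w → w x ≢ x → n < leaves w (w x) →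
                               w y ≢ y → Adj x y → Improvable w
    overfull-leaf-joins-leaf {w} {x} {y} F wx≢x c-over wy≢y adj with w y ≟ w x
    ... | yes wy≡c = overfull-leaf-joins-sibling F wx≢x c-over wy≢y wy≡c adj
    ... | no  wy≢c with leaves w (w y) in d-leaves
    ...   | zero        = contradiction (subst (0 <_) d-leaves (leaf⇒leaves>0 {w} refl (wy≢y ∘ sym))) λ ()
    ...   | suc zero    = overfull-leaf-joins-K₂-leaf F wx≢x c-over wy≢y wy≢c d-leaves adj
    ...   | suc (suc M) = overfull-leaf-joins-star-leaf F wx≢x c-over wy≢y wy≢c d-leaves adj

  module Saturation {n : ℕ} (2≤n : 2 ≤ n) {r k : ℕ} (free : K1r-free G r) (deg : MinDegreeAtLeast G k)
                    (1≤k : 1 ≤ k) (r≤kn+1 : r ≤ k * n + 1) {s : Fin v → Fin v} (F : IsStarForest s) where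
    open LocalMoves 2≤n

    -- A state of the augmenting-path search: w arises from s by shifting leaves one step along a path
    -- of stars centred in R that ends at c, which is overfull in w.
    record Reach (R : Subset v) (c : Fin v) (w : Fin v → Fin v) : Set where
      field
        isStarForest : IsStarForest w
        potential-≤  : potential w ≤ potential s
        overfull-c   : n < leaves w c
        keeps-leaves : ∀ x → s x ≡ c → w x ≡ c
        confined     : ∀ x → w x ≡ s x ⊎ (s x ∈ R × w x ∈ R)
        centre       : s c ≡ c
        saturated    : n ≤ leaves s c

      leaf-stays : ∀ {ℓ} → s ℓ ≡ c → s ℓ ≢ ℓ → w ℓ ≢ ℓ
      leaf-stays sℓ≡c sℓ≢ℓ wℓ≡ℓ = sℓ≢ℓ (trans sℓ≡c (trans (sym (keeps-leaves _ sℓ≡c)) wℓ≡ℓ))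

      overfull-at : ∀ {ℓ} → s ℓ ≡ c → n < leaves w (w ℓ)
      overfull-at sℓ≡c = subst (λ t → n < leaves w t) (sym (keeps-leaves _ sℓ≡c)) overfull-c

    open Reach

    Reach-mono : ∀ {R R′ c w} → R ⊆ R′ → Reach R c w → Reach R′ c w
    Reach-mono R⊆R′ reach = record
      { isStarForest = isStarForest reach
      ; potential-≤  = potential-≤ reach
      ; overfull-c   = overfull-c reach
      ; keeps-leaves = keeps-leaves reach
      ; confined     = λ x → Sum.map₂ (Prod.map R⊆R′ R⊆R′) (confined reach x)
      ; centre       = centre reach
      ; saturated    = saturated reach
      }

    Reach-shift : ∀ {R c w ℓ y} → Reach R c w → c ∈ R → s ℓ ≡ c → s ℓ ≢ ℓ → Adj ℓ y → y ∉ R →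
                  w y ≡ y → n ≤ leaves w y → Reach (R ∪ ⁅ y ⁆) y (w [ ℓ ↦ y ])
    Reach-shift {R} {c} {w} {ℓ} {y} reach c∈R sℓ≡c sℓ≢ℓ adj y∉R wy≡y y-saturated = record
      { isStarForest = join-isStarForest F′ (leaves-of-leaf F′ wℓ≢ℓ) wy≡y adj
      ; potential-≤  = ≤-trans (≤-reflexive (overfull-leaf-joins-saturated-centre F′ wℓ≢ℓ (overfull-at reach sℓ≡c)
                                               wy≡y y≢wℓ y-saturated adj))
                               (potential-≤ reach)
      ; overfull-c   = subst (n <_) (sym (leaves-↦-target w (Adj⇒≢ adj) (y≢wℓ ∘ sym))) (s≤s y-saturated)
      ; keeps-leaves = λ x sx≡y → trans (↦-elsewhere w y (x≢ℓ sx≡y)) (trans (stays-outside sx≡y) sx≡y)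
      ; confined     = confined′
      ; centre       = from-y wy≡y
      ; saturated    = ≤-trans y-saturated (sum-mono-≤ λ a →
                         𝟙-mono (leaf? w a y) (leaf? s a y) (Prod.map₁ from-y))
      }
      where
      F′ = isStarForest reach
      R′ = R ∪ ⁅ y ⁆
      R⊆R′ : R ⊆ R′
      R⊆R′ = p⊆p∪q ⁅ y ⁆
      y∈R′ : y ∈ R′
      y∈R′ = x∈p∪q⁺ (inj₂ (x∈⁅x⁆ y))
      wℓ≢ℓ : w ℓ ≢ ℓ
      wℓ≢ℓ = leaf-stays reach sℓ≡c sℓ≢ℓ
      y≢c : y ≢ c
      y≢c y≡c = y∉R (subst (_∈ R) (sym y≡c) c∈R)
      y≢wℓ : y ≢ w ℓ
      y≢wℓ y≡wℓ = y≢c (trans y≡wℓ (keeps-leaves reach ℓ sℓ≡c))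
      x≢ℓ : ∀ {x} → s x ≡ y → x ≢ ℓ
      x≢ℓ sx≡y x≡ℓ = y≢c (trans (sym sx≡y) (trans (cong s x≡ℓ) sℓ≡c))
      from-y : ∀ {x} → w x ≡ y → s x ≡ y
      from-y {x} wx≡y with confined reach x
      ... | inj₁ wx≡sx       = trans (sym wx≡sx) wx≡y
      ... | inj₂ (_ , wx∈R) = contradiction (subst (_∈ R) wx≡y wx∈R) y∉R
      stays-outside : ∀ {x} → s x ≡ y → w x ≡ s x
      stays-outside {x} sx≡y with confined reach x
      ... | inj₁ wx≡sx       = wx≡sx
      ... | inj₂ (sx∈R , _) = contradiction (subst (_∈ R) sx≡y sx∈R) y∉R
      confined′ : ∀ x → (w [ ℓ ↦ y ]) x ≡ s x ⊎ (s x ∈ R′ × (w [ ℓ ↦ y ]) x ∈ R′)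
      confined′ x with x ≟ ℓ
      ... | yes refl = inj₂ (R⊆R′ (subst (_∈ R) (sym sℓ≡c) c∈R) , subst (_∈ R′) (sym (↦-here w ℓ y)) y∈R′)
      ... | no  x≢ℓ  = subst (λ t → t ≡ s x ⊎ (s x ∈ R′ × t ∈ R′)) (sym (↦-elsewhere w y x≢ℓ))
                         (Sum.map₂ (Prod.map R⊆R′ R⊆R′) (confined reach x))

    Reaches : Subset v → (Fin v → Fin v → Fin v) → Set
    Reaches R W = ∀ {c} → c ∈ R → Reach R c (W c)

    Reaches-insert : ∀ {R W y w′} → Reaches R W → Reach (R ∪ ⁅ y ⁆) y w′ →
                     Reaches (R ∪ ⁅ y ⁆) (updateAt W y (const w′))
    Reaches-insert {R} {W} {y} {w′} reaches reach-y {c} c∈R′ with c ≟ y | x∈p∪q⁻ R ⁅ y ⁆ c∈R′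
    ... | yes refl | _         = subst (Reach (R ∪ ⁅ y ⁆) y) (sym (updateAt-updates y W)) reach-y
    ... | no  c≢y  | inj₁ c∈R  = subst (Reach (R ∪ ⁅ y ⁆) c) (sym (updateAt-minimal c y W c≢y))
                                   (Reach-mono (p⊆p∪q ⁅ y ⁆) (reaches c∈R))
    ... | no  c≢y  | inj₂ c∈⁅y⁆ = contradiction (x∈⁅y⁆⇒x≡y y c∈⁅y⁆) c≢y

    improvable-or-saturated : ∀ {R c w ℓ y} → Reach R c w → c ∈ R → s ℓ ≡ c → s ℓ ≢ ℓ → Adj ℓ y →
                              y ∉ R → Improvable s ⊎ (w y ≡ y × n ≤ leaves w y)
    improvable-or-saturated {R} {c} {w} {ℓ} {y} reach c∈R sℓ≡c sℓ≢ℓ adj y∉R with w y ≟ y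
    ... | no  wy≢y = inj₁ (improvable-≤ {s} {w} (potential-≤ reach)
                       (overfull-leaf-joins-leaf (isStarForest reach) wℓ≢ℓ (overfull-at reach sℓ≡c) wy≢y adj))
      where
      wℓ≢ℓ = leaf-stays reach sℓ≡c sℓ≢ℓ
    ... | yes wy≡y with n ≤? leaves w y
    ...   | yes y-saturated   = inj₂ (wy≡y , y-saturated)
    ...   | no  y-unsaturated = inj₁ (improvable-≤ {s} {w} (potential-≤ reach)
                                 (overfull-leaf-joins-unsaturated-centre (isStarForest reach) (leaf-stays reach sℓ≡c sℓ≢ℓ)
                                   (overfull-at reach sℓ≡c) wy≡y y≢wℓ (≰⇒> y-unsaturated) adj))
      where
      y≢wℓ : y ≢ w ℓ
      y≢wℓ y≡wℓ = y∉R (subst (_∈ R) (sym (trans y≡wℓ (keeps-leaves reach ℓ sℓ≡c))) c∈R)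

    exit? : ∀ R ℓ y → Dec (s ℓ ∈ R × s ℓ ≢ ℓ × Adj ℓ y × y ∉ R)
    exit? R ℓ y = s ℓ ∈? R ×-dec ¬? (s ℓ ≟ ℓ) ×-dec adj? ℓ y ×-dec ¬? (y ∈? R)

    search : ∀ {c₀} → n < leaves s c₀ → ∀ R → Acc _⊃_ R → ∀ W → c₀ ∈ R → Reaches R W → Improvable s
    search c₀-over R (acc larger) W c₀∈R reaches with any? (λ ℓ → any? (λ y → exit? R ℓ y))
    ... | no no-exit = ⊥-elim (no-closed-saturated-family free deg 1≤k r≤kn+1 s R c₀∈R c₀-over
                                 (λ c∈R → centre (reaches c∈R) , saturated (reaches c∈R)) closed)
      where
      closed : ∀ ℓ y → s ℓ ∈ R → s ℓ ≢ ℓ → Adj ℓ y → y ∈ R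
      closed ℓ y sℓ∈R sℓ≢ℓ adj with y ∈? R
      ... | yes y∈R = y∈R
      ... | no  y∉R = contradiction (ℓ , y , sℓ∈R , sℓ≢ℓ , adj , y∉R) no-exit
    ... | yes (ℓ , y , c∈R , sℓ≢ℓ , adj , y∉R)
      with improvable-or-saturated (reaches c∈R) c∈R refl sℓ≢ℓ adj y∉R
    ...   | inj₁ improvable = improvable
    ...   | inj₂ (wy≡y , y-saturated) =
      search c₀-over (R ∪ ⁅ y ⁆) (larger R⊂R′) _ (p⊆p∪q ⁅ y ⁆ c₀∈R)
        (Reaches-insert reaches (Reach-shift (reaches c∈R) c∈R refl sℓ≢ℓ adj y∉R wy≡y y-saturated))
      where
      R⊂R′ : R ⊂ R ∪ ⁅ y ⁆
      R⊂R′ = p⊆p∪q ⁅ y ⁆ , y , x∈p∪q⁺ (inj₂ (x∈⁅x⁆ y)) , y∉R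

    overfull-improvable : ∀ {c₀} → n < leaves s c₀ → Improvable s
    overfull-improvable {c₀} c₀-over = search c₀-over ⁅ c₀ ⁆ (⊃-wellFounded _) (λ _ → s) (x∈⁅x⁆ c₀) reach₀
      where
      reach₀ : ∀ {c} → c ∈ ⁅ c₀ ⁆ → Reach ⁅ c₀ ⁆ c s
      reach₀ c∈⁅c₀⁆ with refl ← x∈⁅y⁆⇒x≡y c₀ c∈⁅c₀⁆ = record
        { isStarForest = F
        ; potential-≤  = ≤-refl
        ; overfull-c   = c₀-over
        ; keeps-leaves = λ _ sx≡c₀ → sx≡c₀
        ; confined     = λ _ → inj₁ refl
        ; centre       = leaves>0⇒centre F (≤-trans (s≤s z≤n) c₀-over)
        ; saturated    = <⇒≤ c₀-over
        }

  module Descent {n : ℕ} (2≤n : 2 ≤ n) {r k : ℕ} (free : K1r-free G r) (deg : MinDegreeAtLeast G k)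
                (1≤k : 1 ≤ k) (r≤kn+1 : r ≤ k * n + 1) where
    open LocalMoves 2≤n

    improve : ∀ {w} → IsStarForest w → 0 < potential w → Improvable w
    improve {w} F P>0 =
      let z , penalty>0     = sum>0⇒∃ {f = penalty w} P>0
          wz≡z , cost>0     = penalty>0⇒centre w penalty>0
      in  improve-at wz≡z (cost>0⇒isolated⊎overfull cost>0)
      where
      improve-at : ∀ {z} → w z ≡ z → leaves w z ≡ 0 ⊎ n < leaves w z → Improvable w
      improve-at _ (inj₂ z-over) = Saturation.overfull-improvable 2≤n free deg 1≤k r≤kn+1 F z-over
      improve-at {z} wz≡z (inj₁ z-none) =
        let y , adj>0 = sum>0⇒∃ {f = λ y → 𝟙 (adj? z y)} (≤-trans 1≤k (subst (k ≤_) (degree≡sum z) (deg z)))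
        in  isolated-joins-neighbour F wz≡z z-none (𝟙-witness (adj? z y) adj>0)

    descend : ∀ w → Acc (_<_ on potential) w → IsStarForest w → SnFactor G n
    descend w (acc smaller) F with potential w in P≡
    ... | zero  = potential≡0⇒SnFactor F P≡
    ... | suc _ with w′ , F′ , P′<P ← improve F (subst (0 <_) (sym P≡) (s≤s z≤n)) =
      descend w′ (smaller (subst (potential w′ <_) P≡ P′<P)) F′

    sn-factor : SnFactor G n
    sn-factor = descend (λ x → x) (On.wellFounded potential <-wellFounded (λ x → x)) discrete-isStarForest

module _ (r n : ℕ) .{{_ : NonZero n}} (2≤r : 2 ≤ r) where

  private
    m = r + n ∸ 2

  1≤[r+n∸2]/n : 1 ≤ (r + n ∸ 2) / n
  1≤[r+n∸2]/n = m≥n⇒m/n>0 (subst (n ≤_) (sym (+-∸-comm n 2≤r)) (m≤n+m n (r ∸ 2)))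

  r≤[r+n∸2]/n*n+1 : r ≤ (r + n ∸ 2) / n * n + 1
  r≤[r+n∸2]/n*n+1 = +-cancelʳ-≤ n r (m / n * n + 1) (begin
    r + n                  ≡⟨ m∸n+n≡m (≤-trans 2≤r (m≤m+n r n)) ⟨
    m + 2                  ≡⟨ +-comm m 2 ⟩
    suc (suc m)            ≤⟨ s≤s (m<[m/n]*n+n m n) ⟩
    suc (m / n * n + n)    ≡⟨ +-assoc 1 (m / n * n) n ⟨
    suc (m / n * n) + n    ≡⟨ cong (_+ n) (+-comm 1 (m / n * n)) ⟩
    m / n * n + 1 + n      ∎)
    where open ≤-Reasoning

theorem3 : (r n : ℕ) → 3 ≤ r → 2 ≤ n → .{{_ : NonZero n}} → (v : ℕ) → (G : Graph v) →
    K1r-free G r →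
    MinDegreeAtLeast G (((r + n) ∸ 2) / n) →
    SnFactor G n
theorem3 r n 3≤r 2≤n v G free deg =
  StarForests.Descent.sn-factor G 2≤n free deg (1≤[r+n∸2]/n r n 2≤r) (r≤[r+n∸2]/n*n+1 r n 2≤r)
  where
  2≤r : 2 ≤ r
  2≤r = ≤-trans (n≤1+n 2) 3≤r
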